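{- Let $I$ be an abelian ideal in $\Phi^+$ and let $\beta_1,\beta_2,\gamma_1,\gamma_2\in I$ be such that $\beta_1+\beta_2=\gamma_1+\gamma_2$, $\beta_i\neq\gamma_j$ for all $i,j\in\{1,2\}$, and $\beta_1\neq\beta_2$. Then: (1) for all $i,j\in\{1,2\}$, $(\beta_i,\gamma_j)>0$; in particular $\beta_i-\gamma_j$ is a root; (2) the set $\{\beta_1,\beta_2,\gamma_1,\gamma_2\}$ has a minimum and a maximum with respect to $\le$, and either $\{\beta_1,\beta_2\}$ or $\{\gamma_1,\gamma_2\}$ is the pair consisting of this minimum and this maximum; (3) $(\beta_1,\beta_2)=0$, unless both $\beta_1,\beta_2$ are short and $\gamma_1,\gamma_2$ have different lengths.
   Context: $\Phi$ is an irreducible crystallographic root system in a Euclidean space with inner product $(\cdot,\cdot)$, $\Phi^+$ a positive system with simple system $\Pi$. The standard partial order: $x\le y$ iff $y-x$ is a nonnegative integer combination of $\Pi$. An abelian ideal of $\Phi^+$ is a subset $I\subseteq\Phi^+$ such that $\beta\in I$, $\gamma\in\Phi^+$, $\beta\le\gamma$ imply $\gamma\in I$, and $\beta+\gamma\notin\Phi$ for all $\beta,\gamma\in I$. Short/long refers to root lengths; if all roots have the same length, all are considered long.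
   Formalization: The inner product $(\cdot,\cdot)$ takes rational values on the simple roots $\Pi$ rather than arbitrary real values. -}

module Defs where

open import Data.Nat using (ℕ; zero; suc)
open import Data.Fin using (Fin) renaming (_≟_ to _Fin≟_)
open import Relation.Nullary.Decidable using (⌊_⌋)
open import Data.Integer as ℤ using (ℤ; +_)
open import Data.Rational as ℚ using (ℚ; 0ℚ; _/_)
open import Data.Vec using (Vec; []; _∷_; lookup; zipWith; replicate; map; tabulate)
open import Data.List using (List)
open import Data.List.Membership.Propositional using (_∈_)
open import Data.Bool using (Bool; true; false; if_then_else_)
open import Data.Product using (Σ; ∃; _×_; _,_)
open import Data.Sum using (_⊎_)
open import Data.Empty using (⊥)
open import Relation.Nullary using (¬_)
open import Relation.Binary.PropositionalEquality using (_≡_; _≢_)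

-- A crystallographic root system Φ of rank n together with a simple
-- system Π = {α₁,…,αₙ} is encoded in coordinates with respect to Π:
-- a vector of the ambient Euclidean space V = span(Π) is written as its
-- coefficient vector in Vec _ n, and αᵢ is the i-th unit vector.  The
-- inner product is given by its Gram matrix B (Bᵢⱼ = (αᵢ,αⱼ)).  Since Φ
-- is irreducible and crystallographic, after rescaling the inner product
-- by a positive real all (αᵢ,αⱼ) are rational; every statement below is
-- invariant under such rescaling, so B has entries in ℚ.

sumFin : (n : ℕ) → (Fin n → ℚ) → ℚ
sumFin zero    f = 0ℚ
sumFin (suc n) f = f Fin.zero ℚ.+ sumFin n (λ i → f (Fin.suc i))

form : {n : ℕ} → (Fin n → Fin n → ℚ) → Vec ℚ n → Vec ℚ n → ℚ
form {n} B x y =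
  sumFin n (λ i → sumFin n (λ j → lookup x i ℚ.* B i j ℚ.* lookup y j))

ZVec : ℕ → Set
ZVec n = Vec ℤ n

toℚ : ℤ → ℚ
toℚ k = k / 1

toℚVec : {n : ℕ} → ZVec n → Vec ℚ n
toℚVec = map toℚ

_⊕_ : {n : ℕ} → ZVec n → ZVec n → ZVec n
_⊕_ = zipWith ℤ._+_

_⊖_ : {n : ℕ} → ZVec n → ZVec n → ZVec n
_⊖_ = zipWith ℤ._-_

_·_ : {n : ℕ} → ℤ → ZVec n → ZVec n
k · v = map (k ℤ.*_) v

neg : {n : ℕ} → ZVec n → ZVec n
neg = map (λ k → ℤ.- k)

unit : {n : ℕ} → Fin n → ZVec n
unit i = tabulate (λ j → if ⌊ i Fin≟ j ⌋ then + 1 else + 0)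

-- the standard partial order: x ≤ y iff y - x is a nonnegative integer
-- combination of Π, i.e. coordinatewise ≤
_≼_ : {n : ℕ} → ZVec n → ZVec n → Set
_≼_ {n} x y = (i : Fin n) → lookup x i ℤ.≤ lookup y i

isNonNeg : {n : ℕ} → ZVec n → Set
isNonNeg {n} x = (i : Fin n) → + 0 ℤ.≤ lookup x i

isNonPos : {n : ℕ} → ZVec n → Set
isNonPos {n} x = (i : Fin n) → lookup x i ℤ.≤ + 0

record RootSystem (n : ℕ) : Set where
  field
    B         : Fin n → Fin n → ℚ
    B-sym     : ∀ i j → B i j ≡ B j i
    B-posdef  : (v : Vec ℚ n) → v ≢ replicate n 0ℚ → 0ℚ ℚ.< form B v v
    roots     : List (ZVec n)

  ⟪_,_⟫ : ZVec n → ZVec n → ℚ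
  ⟪ x , y ⟫ = form B (toℚVec x) (toℚVec y)

  field
    zero∉     : replicate n (+ 0) ∈ roots → ⊥
    reduced   : ∀ {α β} → α ∈ roots → β ∈ roots →
                (∃ λ (c : ℚ) → toℚVec β ≡ map (c ℚ.*_) (toℚVec α)) →
                β ≡ α ⊎ β ≡ neg α
    reflect   : ∀ {α β} → α ∈ roots → β ∈ roots →
                ∃ λ (k : ℤ) → (toℚ (+ 2) ℚ.* ⟪ β , α ⟫ ≡ toℚ k ℚ.* ⟪ α , α ⟫)
                              × ((β ⊖ (k · α)) ∈ roots)
    simple∈   : (i : Fin n) → unit i ∈ roots
    simple    : ∀ {α} → α ∈ roots → isNonNeg α ⊎ isNonPos α
    irreducible : (P : ZVec n → Bool) →
                  (∃ λ α → α ∈ roots × P α ≡ true) →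
                  (∃ λ α → α ∈ roots × P α ≡ false) →
                  (∀ {α β} → α ∈ roots → β ∈ roots → P α ≡ true → P β ≡ false →
                     ⟪ α , β ⟫ ≡ 0ℚ) → ⊥

module _ {n : ℕ} (R : RootSystem n) where
  open RootSystem R

  IsPos : ZVec n → Set
  IsPos α = α ∈ roots × isNonNeg α

  -- a root is short iff some root is strictly longer
  -- (if all roots have the same length, all are long)
  IsShort : ZVec n → Set
  IsShort β = ∃ λ α → α ∈ roots × ⟪ β , β ⟫ ℚ.< ⟪ α , α ⟫

  record AbelianIdeal (I : ZVec n → Set) : Set where
    field
      ⊆pos     : ∀ {β} → I β → IsPos β
      upclosed : ∀ {β γ} → I β → IsPos γ → β ≼ γ → I γ
      abelian  : ∀ {β γ} → I β → I γ → ¬ ((β ⊕ γ) ∈ roots)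

{-# OPTIONS --safe #-}
module Submission where

-- For roots u ≠ ±v with (u, v) > 0 the Cartan integers 2(u, v)/|v|² and 2(v, u)/|u|² are positive
-- with product 4(u, v)²/(|u|²|v|²) < 4, so one of them is 1: u − v is a root and
-- 2(u, v) = max(|u|², |v|²). In an abelian ideal no two roots are obtuse, since u − (−v) = u + v
-- would be a root.
-- (1) If (β₁, γ₁) = 0, pairing β₁ with β₁ + β₂ = γ₁ + γ₂ gives (β₁, γ₂) = |β₁|² + (β₁, β₂), which
-- forces 2(β₁, γ₂) = |γ₂|²; then (β₂, γ₂) > 0, so γ₁ − β₁ = β₂ − γ₂ is a root, and its reflection
-- in γ₁ is −(β₁ + γ₁), contradicting abelianness.
-- (2) By (1), β₁ − γ₁ and β₁ − γ₂ are roots, so β₁ is comparable with γ₁ and with γ₂. Whenever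
-- x₁ + x₂ = y₁ + y₂ and x₁ ≤ y₁, y₂, also y₁, y₂ ≤ x₂, so x₁ and x₂ are the minimum and the maximum.
-- (3) If (β₁, β₂) > 0, pairing βᵢ with the equal sums shows that βᵢ is shorter than γ₁ or γ₂.
-- If moreover |γ₁| = |γ₂|, all 2(βᵢ, γⱼ) equal |γ₁|², whence |γ₁|² = (3/2)|β₁|², contradicting
-- the integrality of 2(γ₁, β₁)/|β₁|².

open import Defs
open import Data.Nat as ℕ using (ℕ; zero; suc)
import Data.Nat.Properties as ℕP
open import Data.Integer as ℤ using (ℤ; +_; -[1+_])
import Data.Integer.Properties as ℤP
open import Data.Integer.Solver renaming (module +-*-Solver to ℤ-Solver)
open import Data.Rational as ℚ using (ℚ; 0ℚ; 1ℚ; _+_; _*_; -_; _-_; _<_; _≤_; _⊔_; toℚᵘ)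
import Data.Rational.Properties as ℚP
open import Data.Rational.Solver renaming (module +-*-Solver to ℚ-Solver)
open import Data.Rational.Unnormalised as ℚᵘ using (mkℚᵘ; *≡*; *≤*; *<*)
import Data.Rational.Unnormalised.Properties as ℚᵘP
open import Data.Fin using (Fin)
open import Data.Vec using (Vec; lookup; replicate; tabulate)
import Data.Vec.Properties as VecP
open import Data.Vec.Relation.Binary.Pointwise.Extensional using (ext; Pointwise-≡⇒≡)
open import Data.List.Membership.Propositional using (_∈_)
open import Data.Product using (Σ; _×_; _,_; proj₁; proj₂)
open import Data.Sum using (_⊎_; inj₁; inj₂; [_,_]′)
open import Data.Empty using (⊥; ⊥-elim)
open import Relation.Nullary using (¬_; yes; no)
open import Relation.Binary.Definitions using (tri<; tri≈; tri>)
open import Relation.Binary.PropositionalEquality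
open import Function using (_∘_)
open import Algebra.Properties.Group ℚP.+-0-group using () renaming (∙-cancelˡ to +-cancelˡ; ∙-cancelʳ to +-cancelʳ)

toℚᵘ∘toℚ : ∀ k → toℚᵘ (toℚ k) ℚᵘ.≃ mkℚᵘ k 0
toℚᵘ∘toℚ k = ℚP.toℚᵘ-fromℚᵘ (mkℚᵘ k 0)

toℚ-homo-+ : ∀ a b → toℚ (a ℤ.+ b) ≡ toℚ a + toℚ b
toℚ-homo-+ a b = ℚP.toℚᵘ-injective (begin
  toℚᵘ (toℚ (a ℤ.+ b))              ≈⟨ toℚᵘ∘toℚ (a ℤ.+ b) ⟩
  mkℚᵘ (a ℤ.+ b) 0                  ≈⟨ *≡* (cong (ℤ._* + 1) (cong₂ ℤ._+_ (sym (ℤP.*-identityʳ a)) (sym (ℤP.*-identityʳ b)))) ⟩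
  mkℚᵘ a 0 ℚᵘ.+ mkℚᵘ b 0            ≈⟨ ℚᵘP.+-cong (toℚᵘ∘toℚ a) (toℚᵘ∘toℚ b) ⟨
  toℚᵘ (toℚ a) ℚᵘ.+ toℚᵘ (toℚ b)    ≈⟨ ℚP.toℚᵘ-homo-+ (toℚ a) (toℚ b) ⟨
  toℚᵘ (toℚ a + toℚ b)              ∎)
  where
  open ℚᵘP.≃-Reasoning

toℚ-homo-* : ∀ a b → toℚ (a ℤ.* b) ≡ toℚ a * toℚ b
toℚ-homo-* a b = ℚP.toℚᵘ-injective (begin
  toℚᵘ (toℚ (a ℤ.* b))              ≈⟨ toℚᵘ∘toℚ (a ℤ.* b) ⟩
  mkℚᵘ (a ℤ.* b) 0                  ≈⟨ ℚᵘP.*-cong (toℚᵘ∘toℚ a) (toℚᵘ∘toℚ b) ⟨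
  toℚᵘ (toℚ a) ℚᵘ.* toℚᵘ (toℚ b)    ≈⟨ ℚP.toℚᵘ-homo-* (toℚ a) (toℚ b) ⟨
  toℚᵘ (toℚ a * toℚ b)              ∎)
  where
  open ℚᵘP.≃-Reasoning

toℚ-homo‿- : ∀ a → toℚ (ℤ.- a) ≡ - toℚ a
toℚ-homo‿- a = ℚP.toℚᵘ-injective (begin
  toℚᵘ (toℚ (ℤ.- a))   ≈⟨ toℚᵘ∘toℚ (ℤ.- a) ⟩
  mkℚᵘ (ℤ.- a) 0       ≈⟨ ℚᵘP.-‿cong (toℚᵘ∘toℚ a) ⟨
  ℚᵘ.- toℚᵘ (toℚ a)    ≈⟨ ℚP.toℚᵘ-homo‿- (toℚ a) ⟨
  toℚᵘ (- toℚ a)       ∎)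
  where
  open ℚᵘP.≃-Reasoning

toℚ-homo-minus : ∀ a b → toℚ (a ℤ.- b) ≡ toℚ a - toℚ b
toℚ-homo-minus a b = trans (toℚ-homo-+ a (ℤ.- b)) (cong (λ x → toℚ a + x) (toℚ-homo‿- b))

toℚ-injective : ∀ {a b} → toℚ a ≡ toℚ b → a ≡ b
toℚ-injective {a} {b} eq
  with *≡* e ← ℚᵘP.≃-trans (ℚᵘP.≃-sym (toℚᵘ∘toℚ a)) (ℚᵘP.≃-trans (ℚP.toℚᵘ-cong eq) (toℚᵘ∘toℚ b))
  = trans (sym (ℤP.*-identityʳ a)) (trans e (ℤP.*-identityʳ b))

toℚ-cancel-< : ∀ {a b} → toℚ a < toℚ b → a ℤ.< b
toℚ-cancel-< {a} {b} lt
  with *<* e ← ℚᵘP.<-respˡ-≃ (toℚᵘ∘toℚ a) (ℚᵘP.<-respʳ-≃ (toℚᵘ∘toℚ b) (ℚP.toℚᵘ-mono-< lt))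
  = subst₂ ℤ._<_ (ℤP.*-identityʳ a) (ℤP.*-identityʳ b) e

toℚ-mono-≤ : ∀ {a b} → a ℤ.≤ b → toℚ a ≤ toℚ b
toℚ-mono-≤ {a} {b} le = ℚP.toℚᵘ-cancel-≤
  (ℚᵘP.≤-respˡ-≃ (ℚᵘP.≃-sym (toℚᵘ∘toℚ a)) (ℚᵘP.≤-respʳ-≃ (ℚᵘP.≃-sym (toℚᵘ∘toℚ b))
    (*≤* (subst₂ ℤ._≤_ (sym (ℤP.*-identityʳ a)) (sym (ℤP.*-identityʳ b)) le))))

positive-factors-of-<4 : ∀ k l → + 0 ℤ.< k → + 0 ℤ.< l → k ℤ.* l ℤ.< + 4 → k ≡ + 1 ⊎ l ≡ + 1
positive-factors-of-<4 (+ 1) l _ _ _ = inj₁ refl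
positive-factors-of-<4 k (+ 1) _ _ _ = inj₂ refl
positive-factors-of-<4 (+ suc (suc m)) (+ suc (suc m′)) _ _ (ℤ.+<+ kl<4) =
  ⊥-elim (ℕP.<⇒≱ kl<4 (ℕP.*-mono-≤ {2} {suc (suc m)} {2} {suc (suc m′)} 2≤ 2≤))
  where
  2≤ : ∀ {k} → 2 ℕ.≤ suc (suc k)
  2≤ = ℕ.s≤s (ℕ.s≤s ℕ.z≤n)
positive-factors-of-<4 (+ 0) l (ℤ.+<+ ()) _ _
positive-factors-of-<4 (+ suc (suc m)) (+ 0) _ (ℤ.+<+ ()) _

3≢k+k : ∀ k → + 3 ≢ k ℤ.+ k
3≢k+k (+ 0) ()
3≢k+k (+ 1) ()
3≢k+k (+ suc (suc m)) eq = ℕP.<⇒≢ (ℕP.+-mono-≤ {2} {suc (suc m)} {2} {suc (suc m)} 2≤ 2≤) (ℤP.+-injective eq)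
  where
  2≤ = ℕ.s≤s (ℕ.s≤s ℕ.z≤n)
3≢k+k -[1+ m ] ()

two : ℚ
two = toℚ (+ 2)

0<two : 0ℚ < two
0<two = ℚ.*<* (ℤ.+<+ (ℕ.s≤s ℕ.z≤n))

0<p⇒0<two*p : ∀ {p} → 0ℚ < p → 0ℚ < two * p
0<p⇒0<two*p {p} 0<p = subst (_< two * p) (ℚP.*-zeroʳ two) (ℚP.*-monoʳ-<-pos two 0<p)

0<q-p⇒p<q : ∀ {p q} → 0ℚ < q - p → p < q
0<q-p⇒p<q {p} {q} 0<q-p =
  subst₂ _<_ (ℚP.+-identityˡ p) (solve 2 (λ p q → (q :- p) :+ p := q) refl p q) (ℚP.+-monoˡ-< p 0<q-p)
  where
  open ℚ-Solver

*-cancelʳ-≡-pos : ∀ {r p q} → 0ℚ < r → p * r ≡ q * r → p ≡ q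
*-cancelʳ-≡-pos {r} 0<r eq = ℚP.≤-antisym (ℚP.*-cancelʳ-≤-pos r {{ℚ.positive 0<r}} (ℚP.≤-reflexive eq))
                                          (ℚP.*-cancelʳ-≤-pos r {{ℚ.positive 0<r}} (ℚP.≤-reflexive (sym eq)))

0<p*r⇒0<p : ∀ {r p} → 0ℚ < r → 0ℚ < p * r → 0ℚ < p
0<p*r⇒0<p {r} {p} 0<r 0<pr =
  ℚP.*-cancelʳ-<-nonNeg r {{ℚ.nonNegative (ℚP.<⇒≤ 0<r)}} (subst (_< p * r) (sym (ℚP.*-zeroˡ r)) 0<pr)

0<k⇒p≤k*p : ∀ {k p} → + 0 ℤ.< k → 0ℚ ≤ p → p ≤ toℚ k * p
0<k⇒p≤k*p {k} {p} (ℤ.+<+ 0<k) 0≤p = subst (_≤ toℚ k * p) (ℚP.*-identityˡ p)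
  (ℚP.*-monoʳ-≤-nonNeg p {{ℚ.nonNegative 0≤p}} (toℚ-mono-≤ {+ 1} {k} (ℤ.+≤+ 0<k)))

ax-cy≡0⇒x≡c/a*y : ∀ a c .{{_ : ℚ.NonZero a}} x y → a * x + (- c) * y ≡ 0ℚ → x ≡ (c * ℚ.1/ a) * y
ax-cy≡0⇒x≡c/a*y a c x y ax-cy≡0 = begin
  x                                          ≡⟨ ℚP.*-identityˡ x ⟨
  1ℚ * x                                     ≡⟨ cong (_* x) (ℚP.*-inverseˡ a) ⟨
  (a⁻¹ * a) * x                              ≡⟨ regroup a⁻¹ a x c y ⟩
  a⁻¹ * (a * x + (- c) * y) + (c * a⁻¹) * y  ≡⟨ cong (λ z → a⁻¹ * z + (c * a⁻¹) * y) ax-cy≡0 ⟩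
  a⁻¹ * 0ℚ + (c * a⁻¹) * y                   ≡⟨ cong (_+ (c * a⁻¹) * y) (ℚP.*-zeroʳ a⁻¹) ⟩
  0ℚ + (c * a⁻¹) * y                         ≡⟨ ℚP.+-identityˡ ((c * a⁻¹) * y) ⟩
  (c * a⁻¹) * y                              ∎
  where
  open ≡-Reasoning
  open ℚ-Solver
  a⁻¹ = ℚ.1/ a
  regroup = solve 5 (λ a⁻¹ a x c y → (a⁻¹ :* a) :* x := a⁻¹ :* (a :* x :+ (:- c) :* y) :+ (c :* a⁻¹) :* y) refl

≤∧≢⇒< : ∀ {p q} → p ≤ q → p ≢ q → p < q
≤∧≢⇒< {p} {q} p≤q p≢q with ℚP.<-cmp p q
... | tri< p<q _ _ = p<q
... | tri≈ _ p≡q _ = ⊥-elim (p≢q p≡q)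
... | tri> _ _ q<p = ⊥-elim (ℚP.<-irrefl refl (ℚP.<-≤-trans q<p p≤q))

p<p⊔q⇒p⊔q≡q : ∀ {p q} → p < p ⊔ q → p ⊔ q ≡ q
p<p⊔q⇒p⊔q≡q {p} {q} p<p⊔q with ℚP.≤-total p q
... | inj₁ p≤q = ℚP.p≤q⇒p⊔q≡q p≤q
... | inj₂ q≤p = ⊥-elim (ℚP.<-irrefl (sym (ℚP.p≥q⇒p⊔q≡p q≤p)) p<p⊔q)

halves-sum : ∀ {p p′ g} → two * p ≡ g → two * p′ ≡ g → p + p′ ≡ g
halves-sum {p} {p′} {g} 2p≡g 2p′≡g = *-cancelʳ-≡-pos 0<two (begin
  (p + p′) * two       ≡⟨ solve 2 (λ p p′ → (p :+ p′) :* con two := con two :* p :+ con two :* p′) refl p p′ ⟩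
  two * p + two * p′   ≡⟨ cong₂ _+_ 2p≡g 2p′≡g ⟩
  g + g                ≡⟨ solve 1 (λ g → g :+ g := g :* con two) refl g ⟩
  g * two              ∎)
  where
  open ≡-Reasoning
  open ℚ-Solver

b+b/2≢k*b : ∀ {b q} k → 0ℚ < b → two * q ≡ b → b + q ≢ toℚ k * b
b+b/2≢k*b {b} {q} k 0<b 2q≡b b+q≡kb = 3≢k+k k (toℚ-injective (*-cancelʳ-≡-pos 0<b (begin
  toℚ (+ 3) * b                  ≡⟨ solve 2 (λ b q → con (toℚ (+ 3)) :* b := con two :* (b :+ q) :+ (b :- con two :* q)) refl b q ⟩
  two * (b + q) + (b - two * q)  ≡⟨ cong₂ (λ x y → two * x + (b - y)) b+q≡kb 2q≡b ⟩
  two * (toℚ k * b) + (b - b)    ≡⟨ solve 2 (λ k b → con two :* (k :* b) :+ (b :- b) := (k :+ k) :* b) refl (toℚ k) b ⟩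
  (toℚ k + toℚ k) * b            ≡⟨ cong (_* b) (toℚ-homo-+ k k) ⟨
  toℚ (k ℤ.+ k) * b              ∎)))
  where
  open ≡-Reasoning
  open ℚ-Solver

sumFin-cong : ∀ n {f g : Fin n → ℚ} → (∀ i → f i ≡ g i) → sumFin n f ≡ sumFin n g
sumFin-cong zero    f≗g = refl
sumFin-cong (suc n) f≗g = cong₂ _+_ (f≗g Fin.zero) (sumFin-cong n (λ i → f≗g (Fin.suc i)))

sumFin-+ : ∀ n (f g : Fin n → ℚ) → sumFin n (λ i → f i + g i) ≡ sumFin n f + sumFin n g
sumFin-+ zero    f g = refl
sumFin-+ (suc n) f g = begin
  (f₀ + g₀) + sumFin n (λ i → f₊ i + g₊ i)  ≡⟨ cong (_+_ (f₀ + g₀)) (sumFin-+ n f₊ g₊) ⟩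
  (f₀ + g₀) + (sumFin n f₊ + sumFin n g₊)    ≡⟨ interchange f₀ g₀ (sumFin n f₊) (sumFin n g₊) ⟩
  (f₀ + sumFin n f₊) + (g₀ + sumFin n g₊)    ∎
  where
  open ≡-Reasoning
  f₀ = f Fin.zero
  g₀ = g Fin.zero
  f₊ = λ i → f (Fin.suc i)
  g₊ = λ i → g (Fin.suc i)
  interchange : ∀ a b c d → (a + b) + (c + d) ≡ (a + c) + (b + d)
  interchange = solve 4 (λ a b c d → (a :+ b) :+ (c :+ d) := (a :+ c) :+ (b :+ d)) refl
    where
    open ℚ-Solver

sumFin-* : ∀ n c (f : Fin n → ℚ) → sumFin n (λ i → c * f i) ≡ c * sumFin n f
sumFin-* zero    c f = sym (ℚP.*-zeroʳ c)
sumFin-* (suc n) c f = trans (cong (λ s → c * f Fin.zero + s) (sumFin-* n c _)) (sym (ℚP.*-distribˡ-+ c _ _))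

sumFin-0 : ∀ n → sumFin n (λ _ → 0ℚ) ≡ 0ℚ
sumFin-0 zero    = refl
sumFin-0 (suc n) = cong (_+_ 0ℚ) (sumFin-0 n)

sumFin-swap : ∀ n m (f : Fin n → Fin m → ℚ) →
              sumFin n (λ i → sumFin m (f i)) ≡ sumFin m (λ j → sumFin n (λ i → f i j))
sumFin-swap zero    m f = sym (sumFin-0 m)
sumFin-swap (suc n) m f = trans (cong (_+_ (sumFin m (f Fin.zero))) (sumFin-swap n m (λ i → f (Fin.suc i))))
                                (sym (sumFin-+ m _ _))

module _ {n : ℕ} (B : Fin n → Fin n → ℚ) where

  form-sym : (∀ i j → B i j ≡ B j i) → ∀ x y → form B x y ≡ form B y x
  form-sym B-sym x y = trans (sumFin-swap n n _) (sumFin-cong n λ j → sumFin-cong n λ i → swapped j i)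
    where
    swapped : ∀ j i → lookup x i * B i j * lookup y j ≡ lookup y j * B j i * lookup x i
    swapped j i rewrite B-sym i j = solve 3 (λ a b c → a :* b :* c := c :* b :* a) refl (lookup x i) (B j i) (lookup y j)
      where
      open ℚ-Solver

  form-linearˡ : ∀ s t x y z w → (∀ i → lookup z i ≡ s * lookup x i + t * lookup y i) →
                 form B z w ≡ s * form B x w + t * form B y w
  form-linearˡ s t x y z w z≡sx+ty = trans (sumFin-cong n λ i → trans (sumFin-cong n (termwise i)) split) split
    where
    split : ∀ {f g : Fin n → ℚ} → sumFin n (λ j → s * f j + t * g j) ≡ s * sumFin n f + t * sumFin n g
    split = trans (sumFin-+ n _ _) (cong₂ _+_ (sumFin-* n s _) (sumFin-* n t _))
    termwise : ∀ i j → lookup z i * B i j * lookup w j ≡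
                       s * (lookup x i * B i j * lookup w j) + t * (lookup y i * B i j * lookup w j)
    termwise i j rewrite z≡sx+ty i =
      solve 6 (λ s t a b c d → (s :* a :+ t :* b) :* c :* d := s :* (a :* c :* d) :+ t :* (b :* c :* d))
              refl s t (lookup x i) (lookup y i) (B i j) (lookup w j)
      where
      open ℚ-Solver

lookup-extensional : ∀ {A : Set} {n} {x y : Vec A n} → (∀ i → lookup x i ≡ lookup y i) → x ≡ y
lookup-extensional x≗y = Pointwise-≡⇒≡ (ext x≗y)

module _ {n : ℕ} where

  lookup-⊕ : ∀ (x y : ZVec n) i → lookup (x ⊕ y) i ≡ lookup x i ℤ.+ lookup y i
  lookup-⊕ x y i = VecP.lookup-zipWith ℤ._+_ i x y

  lookup-⊖ : ∀ (x y : ZVec n) i → lookup (x ⊖ y) i ≡ lookup x i ℤ.- lookup y i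
  lookup-⊖ x y i = VecP.lookup-zipWith ℤ._-_ i x y

  lookup-neg : ∀ (x : ZVec n) i → lookup (neg x) i ≡ ℤ.- lookup x i
  lookup-neg x i = VecP.lookup-map i _ x

  lookup-· : ∀ k (x : ZVec n) i → lookup (k · x) i ≡ k ℤ.* lookup x i
  lookup-· k x i = VecP.lookup-map i _ x

  lookup-toℚVec : ∀ (x : ZVec n) i → lookup (toℚVec x) i ≡ toℚ (lookup x i)
  lookup-toℚVec x i = VecP.lookup-map i _ x

  toℚVec-injective-0 : ∀ (x : ZVec n) → toℚVec x ≡ replicate n 0ℚ → x ≡ replicate n (+ 0)
  toℚVec-injective-0 x x≡0 = lookup-extensional λ i → begin
    lookup x i                   ≡⟨ toℚ-injective (begin
                                      toℚ (lookup x i)              ≡⟨ lookup-toℚVec x i ⟨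
                                      lookup (toℚVec x) i           ≡⟨ cong (λ v → lookup v i) x≡0 ⟩
                                      lookup (replicate n 0ℚ) i     ≡⟨ VecP.lookup-replicate i 0ℚ ⟩
                                      toℚ (+ 0)                     ∎) ⟩
    + 0                          ≡⟨ VecP.lookup-replicate i (+ 0) ⟨
    lookup (replicate n (+ 0)) i ∎
    where
    open ≡-Reasoning

  nonNeg∧nonPos⇒0 : ∀ {x : ZVec n} → isNonNeg x → isNonPos x → x ≡ replicate n (+ 0)
  nonNeg∧nonPos⇒0 x≥0 x≤0 = lookup-extensional λ i →
    trans (ℤP.≤-antisym (x≤0 i) (x≥0 i)) (sym (VecP.lookup-replicate i (+ 0)))

  neg-nonNeg : ∀ {x : ZVec n} → isNonNeg x → isNonPos (neg x)
  neg-nonNeg {x} x≥0 i = subst (ℤ._≤ + 0) (sym (lookup-neg x i)) (ℤP.neg-mono-≤ (x≥0 i))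

  neg-injective : ∀ {x y : ZVec n} → neg x ≡ neg y → x ≡ y
  neg-injective {x} {y} eq = lookup-extensional λ i →
    ℤP.neg-injective (trans (sym (lookup-neg x i)) (trans (cong (λ v → lookup v i) eq) (lookup-neg y i)))

  ⊕-comm : ∀ (x y : ZVec n) → x ⊕ y ≡ y ⊕ x
  ⊕-comm = VecP.zipWith-comm ℤP.+-comm

  ⊖-neg : ∀ (x y : ZVec n) → x ⊖ neg y ≡ x ⊕ y
  ⊖-neg x y = lookup-extensional λ i → begin
    lookup (x ⊖ neg y) i                 ≡⟨ lookup-⊖ x (neg y) i ⟩
    lookup x i ℤ.- lookup (neg y) i      ≡⟨ cong (ℤ._-_ (lookup x i)) (lookup-neg y i) ⟩
    lookup x i ℤ.- ℤ.- lookup y i        ≡⟨ cong (ℤ._+_ (lookup x i)) (ℤP.neg-involutive (lookup y i)) ⟩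
    lookup x i ℤ.+ lookup y i            ≡⟨ lookup-⊕ x y i ⟨
    lookup (x ⊕ y) i                     ∎
    where
    open ≡-Reasoning

  ⊖-1· : ∀ (x y : ZVec n) → x ⊖ ((+ 1) · y) ≡ x ⊖ y
  ⊖-1· x y = lookup-extensional λ i → begin
    lookup (x ⊖ ((+ 1) · y)) i                ≡⟨ lookup-⊖ x ((+ 1) · y) i ⟩
    lookup x i ℤ.- lookup ((+ 1) · y) i       ≡⟨ cong (ℤ._-_ (lookup x i)) (trans (lookup-· (+ 1) y i) (ℤP.*-identityˡ _)) ⟩
    lookup x i ℤ.- lookup y i                 ≡⟨ lookup-⊖ x y i ⟨
    lookup (x ⊖ y) i                          ∎
    where
    open ≡-Reasoning

  ⊖-2·-self : ∀ (x : ZVec n) → x ⊖ ((+ 2) · x) ≡ neg x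
  ⊖-2·-self x = lookup-extensional λ i → begin
    lookup (x ⊖ ((+ 2) · x)) i                ≡⟨ lookup-⊖ x ((+ 2) · x) i ⟩
    lookup x i ℤ.- lookup ((+ 2) · x) i       ≡⟨ cong (ℤ._-_ (lookup x i)) (lookup-· (+ 2) x i) ⟩
    lookup x i ℤ.- + 2 ℤ.* lookup x i         ≡⟨ solve 1 (λ a → a :- con (+ 2) :* a := :- a) refl (lookup x i) ⟩
    ℤ.- lookup x i                            ≡⟨ lookup-neg x i ⟨
    lookup (neg x) i                          ∎
    where
    open ≡-Reasoning
    open ℤ-Solver

  neg-⊖ : ∀ (x y : ZVec n) → neg (x ⊖ y) ≡ y ⊖ x
  neg-⊖ x y = lookup-extensional λ i → begin
    lookup (neg (x ⊖ y)) i                  ≡⟨ trans (lookup-neg (x ⊖ y) i) (cong ℤ.-_ (lookup-⊖ x y i)) ⟩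
    ℤ.- (lookup x i ℤ.- lookup y i)         ≡⟨ solve 2 (λ a b → :- (a :- b) := b :- a) refl (lookup x i) (lookup y i) ⟩
    lookup y i ℤ.- lookup x i               ≡⟨ lookup-⊖ y x i ⟨
    lookup (y ⊖ x) i                        ∎
    where
    open ℤ-Solver
    open ≡-Reasoning

  neg-[⊖-2·] : ∀ (x y : ZVec n) → neg ((y ⊖ x) ⊖ ((+ 2) · y)) ≡ x ⊕ y
  neg-[⊖-2·] x y = lookup-extensional λ i → begin
    lookup (neg ((y ⊖ x) ⊖ ((+ 2) · y))) i                   ≡⟨ lookup-neg ((y ⊖ x) ⊖ ((+ 2) · y)) i ⟩
    ℤ.- lookup ((y ⊖ x) ⊖ ((+ 2) · y)) i                     ≡⟨ cong ℤ.-_ (lookup-⊖ (y ⊖ x) ((+ 2) · y) i) ⟩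
    ℤ.- (lookup (y ⊖ x) i ℤ.- lookup ((+ 2) · y) i)          ≡⟨ cong₂ (λ s t → ℤ.- (s ℤ.- t)) (lookup-⊖ y x i) (lookup-· (+ 2) y i) ⟩
    ℤ.- ((lookup y i ℤ.- lookup x i) ℤ.- + 2 ℤ.* lookup y i)  ≡⟨ solve 2 (λ a b → :- ((b :- a) :- con (+ 2) :* b) := a :+ b) refl (lookup x i) (lookup y i) ⟩
    lookup x i ℤ.+ lookup y i                                ≡⟨ lookup-⊕ x y i ⟨
    lookup (x ⊕ y) i                                         ∎
    where
    open ℤ-Solver
    open ≡-Reasoning

  ⊕-≡⇒⊖-≡ : ∀ {a b c d : ZVec n} → a ⊕ b ≡ c ⊕ d → b ⊖ d ≡ c ⊖ a
  ⊕-≡⇒⊖-≡ {a} {b} {c} {d} eq = lookup-extensional λ i → begin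
    lookup (b ⊖ d) i                                             ≡⟨ lookup-⊖ b d i ⟩
    lookup b i ℤ.- lookup d i                                    ≡⟨ cancel-a (lookup a i) (lookup b i) (lookup d i) ⟨
    (lookup a i ℤ.+ lookup b i) ℤ.- (lookup a i ℤ.+ lookup d i)  ≡⟨ cong (ℤ._- (lookup a i ℤ.+ lookup d i)) (sums i) ⟩
    (lookup c i ℤ.+ lookup d i) ℤ.- (lookup a i ℤ.+ lookup d i)  ≡⟨ cancel-d (lookup a i) (lookup c i) (lookup d i) ⟩
    lookup c i ℤ.- lookup a i                                    ≡⟨ lookup-⊖ c a i ⟨
    lookup (c ⊖ a) i                                             ∎
    where
    open ℤ-Solver
    open ≡-Reasoning
    sums : ∀ i → lookup a i ℤ.+ lookup b i ≡ lookup c i ℤ.+ lookup d i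
    sums i = trans (sym (lookup-⊕ a b i)) (trans (cong (λ v → lookup v i) eq) (lookup-⊕ c d i))
    cancel-a : ∀ a b d → (a ℤ.+ b) ℤ.- (a ℤ.+ d) ≡ b ℤ.- d
    cancel-a = solve 3 (λ a b d → (a :+ b) :- (a :+ d) := b :- d) refl
    cancel-d : ∀ a c d → (c ℤ.+ d) ℤ.- (a ℤ.+ d) ≡ c ℤ.- a
    cancel-d = solve 3 (λ a c d → (c :+ d) :- (a :+ d) := c :- a) refl

  ⊖-nonNeg⇒≼ : ∀ {x y : ZVec n} → isNonNeg (x ⊖ y) → y ≼ x
  ⊖-nonNeg⇒≼ {x} {y} x-y≥0 i = ℤP.0≤i-j⇒j≤i (subst (ℤ._≤_ (+ 0)) (lookup-⊖ x y i) (x-y≥0 i))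

  ⊖-nonPos⇒≼ : ∀ {x y : ZVec n} → isNonPos (x ⊖ y) → x ≼ y
  ⊖-nonPos⇒≼ {x} {y} x-y≤0 i = ℤP.i-j≤0⇒i≤j (subst (ℤ._≤ + 0) (lookup-⊖ x y i) (x-y≤0 i))

  ≼⇒⊖-nonNeg : ∀ {x y : ZVec n} → y ≼ x → isNonNeg (x ⊖ y)
  ≼⇒⊖-nonNeg {x} {y} y≼x i = subst (ℤ._≤_ (+ 0)) (sym (lookup-⊖ x y i)) (ℤP.i≤j⇒0≤j-i (y≼x i))

  ≼-refl : ∀ {x : ZVec n} → x ≼ x
  ≼-refl i = ℤP.≤-refl

  ≼-trans : ∀ {x y z : ZVec n} → x ≼ y → y ≼ z → x ≼ z
  ≼-trans x≼y y≼z i = ℤP.≤-trans (x≼y i) (y≼z i)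

  ≼-complement : ∀ {a b c d : ZVec n} → a ⊕ b ≡ c ⊕ d → a ≼ c → d ≼ b
  ≼-complement {a} {b} {c} {d} eq a≼c = ⊖-nonNeg⇒≼ {b} {d} (subst isNonNeg (sym (⊕-≡⇒⊖-≡ eq)) (≼⇒⊖-nonNeg {c} {a} a≼c))

  Among : ZVec n → ZVec n → ZVec n → ZVec n → ZVec n → Set
  Among z a b c d = z ≡ a ⊎ z ≡ b ⊎ z ≡ c ⊎ z ≡ d

  Among-swap₁₂ : ∀ {z a b c d} → Among z a b c d → Among z b a c d
  Among-swap₁₂ (inj₁ z≡a)        = inj₂ (inj₁ z≡a)
  Among-swap₁₂ (inj₂ (inj₁ z≡b)) = inj₁ z≡b
  Among-swap₁₂ (inj₂ (inj₂ z∈))  = inj₂ (inj₂ z∈)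

  Among-swap-pairs : ∀ {z a b c d} → Among z a b c d → Among z c d a b
  Among-swap-pairs (inj₁ z≡a)               = inj₂ (inj₂ (inj₁ z≡a))
  Among-swap-pairs (inj₂ (inj₁ z≡b))        = inj₂ (inj₂ (inj₂ z≡b))
  Among-swap-pairs (inj₂ (inj₂ (inj₁ z≡c))) = inj₁ z≡c
  Among-swap-pairs (inj₂ (inj₂ (inj₂ z≡d))) = inj₂ (inj₁ z≡d)

  least⇒interval : ∀ {x₁ x₂ y₁ y₂} → x₁ ⊕ x₂ ≡ y₁ ⊕ y₂ → x₁ ≼ y₁ → x₁ ≼ y₂ →
                 ∀ {z} → Among z x₁ x₂ y₁ y₂ → x₁ ≼ z × z ≼ x₂
  least⇒interval {x₁} {x₂} {y₁} {y₂} sums x₁≼y₁ x₁≼y₂ = spans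
    where
    y₁≼x₂ : y₁ ≼ x₂
    y₁≼x₂ = ≼-complement (trans sums (⊕-comm y₁ y₂)) x₁≼y₂
    y₂≼x₂ : y₂ ≼ x₂
    y₂≼x₂ = ≼-complement sums x₁≼y₁
    x₁≼x₂ : x₁ ≼ x₂
    x₁≼x₂ = ≼-trans {x = x₁} {y₁} {x₂} x₁≼y₁ y₁≼x₂
    spans : ∀ {z} → Among z x₁ x₂ y₁ y₂ → x₁ ≼ z × z ≼ x₂
    spans (inj₁ refl)               = ≼-refl {x = x₁} , x₁≼x₂
    spans (inj₂ (inj₁ refl))        = x₁≼x₂ , ≼-refl {x = x₂}
    spans (inj₂ (inj₂ (inj₁ refl))) = x₁≼y₁ , y₁≼x₂
    spans (inj₂ (inj₂ (inj₂ refl))) = x₁≼y₂ , y₂≼x₂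

  ExtremalPair : ZVec n → ZVec n → ZVec n → ZVec n → Set
  ExtremalPair β₁ β₂ γ₁ γ₂ = Σ (ZVec n) λ m → Σ (ZVec n) λ M →
    Among m β₁ β₂ γ₁ γ₂ × Among M β₁ β₂ γ₁ γ₂ × ((x : ZVec n) → Among x β₁ β₂ γ₁ γ₂ → (m ≼ x) × (x ≼ M))
    × (((β₁ ≡ m × β₂ ≡ M) ⊎ (β₁ ≡ M × β₂ ≡ m)) ⊎ ((γ₁ ≡ m × γ₂ ≡ M) ⊎ (γ₁ ≡ M × γ₂ ≡ m)))

  comparable⇒ExtremalPair : ∀ {β₁ β₂ γ₁ γ₂} → β₁ ⊕ β₂ ≡ γ₁ ⊕ γ₂ →
                            γ₁ ≼ β₁ ⊎ β₁ ≼ γ₁ → γ₂ ≼ β₁ ⊎ β₁ ≼ γ₂ → ExtremalPair β₁ β₂ γ₁ γ₂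
  comparable⇒ExtremalPair {β₁} {β₂} {γ₁} {γ₂} sums = cases
    where
    cases : γ₁ ≼ β₁ ⊎ β₁ ≼ γ₁ → γ₂ ≼ β₁ ⊎ β₁ ≼ γ₂ → ExtremalPair β₁ β₂ γ₁ γ₂
    cases (inj₂ β₁≼γ₁) (inj₂ β₁≼γ₂) =
      β₁ , β₂ , inj₁ refl , inj₂ (inj₁ refl) ,
      (λ _ → least⇒interval sums β₁≼γ₁ β₁≼γ₂) , inj₁ (inj₁ (refl , refl))
    cases (inj₁ γ₁≼β₁) (inj₁ γ₂≼β₁) =
      β₂ , β₁ , inj₂ (inj₁ refl) , inj₁ refl ,
      (λ _ → least⇒interval (trans (⊕-comm β₂ β₁) sums)
               (≼-complement (trans (⊕-comm γ₂ γ₁) (sym sums)) γ₂≼β₁) (≼-complement (sym sums) γ₁≼β₁)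
             ∘ Among-swap₁₂) ,
      inj₁ (inj₂ (refl , refl))
    cases (inj₂ β₁≼γ₁) (inj₁ γ₂≼β₁) =
      γ₂ , γ₁ , inj₂ (inj₂ (inj₂ refl)) , inj₂ (inj₂ (inj₁ refl)) ,
      (λ _ → least⇒interval (trans (⊕-comm γ₂ γ₁) (sym sums)) γ₂≼β₁ (≼-complement sums β₁≼γ₁)
             ∘ Among-swap₁₂ ∘ Among-swap-pairs) ,
      inj₂ (inj₂ (refl , refl))
    cases (inj₁ γ₁≼β₁) (inj₂ β₁≼γ₂) =
      γ₁ , γ₂ , inj₂ (inj₂ (inj₁ refl)) , inj₂ (inj₂ (inj₂ refl)) ,
      (λ _ → least⇒interval (sym sums) γ₁≼β₁ (≼-complement (trans sums (⊕-comm γ₁ γ₂)) β₁≼γ₂) ∘ Among-swap-pairs) ,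
      inj₂ (inj₁ (refl , refl))

module RootSystemProperties {n : ℕ} (R : RootSystem n) where
  open RootSystem R

  ⟪⟫-sym : ∀ x y → ⟪ x , y ⟫ ≡ ⟪ y , x ⟫
  ⟪⟫-sym x y = form-sym B B-sym (toℚVec x) (toℚVec y)

  ⟪⟫-linearˡ : ∀ s t x y z w → (∀ i → toℚ (lookup z i) ≡ s * toℚ (lookup x i) + t * toℚ (lookup y i)) →
               ⟪ z , w ⟫ ≡ s * ⟪ x , w ⟫ + t * ⟪ y , w ⟫
  ⟪⟫-linearˡ s t x y z w z≡sx+ty = form-linearˡ B s t (toℚVec x) (toℚVec y) (toℚVec z) (toℚVec w) λ i →
    trans (lookup-toℚVec z i)
      (trans (z≡sx+ty i) (sym (cong₂ (λ p q → s * p + t * q) (lookup-toℚVec x i) (lookup-toℚVec y i))))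

  ⟪⟫-distribʳ-⊕ : ∀ x y z → ⟪ z , x ⊕ y ⟫ ≡ ⟪ z , x ⟫ + ⟪ z , y ⟫
  ⟪⟫-distribʳ-⊕ x y z = begin
    ⟪ z , x ⊕ y ⟫                    ≡⟨ ⟪⟫-sym z (x ⊕ y) ⟩
    ⟪ x ⊕ y , z ⟫                    ≡⟨ ⟪⟫-linearˡ 1ℚ 1ℚ x y (x ⊕ y) z coords ⟩
    1ℚ * ⟪ x , z ⟫ + 1ℚ * ⟪ y , z ⟫  ≡⟨ cong₂ _+_ (ℚP.*-identityˡ ⟪ x , z ⟫) (ℚP.*-identityˡ ⟪ y , z ⟫) ⟩
    ⟪ x , z ⟫ + ⟪ y , z ⟫            ≡⟨ cong₂ _+_ (⟪⟫-sym x z) (⟪⟫-sym y z) ⟩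
    ⟪ z , x ⟫ + ⟪ z , y ⟫            ∎
    where
    open ≡-Reasoning
    coords : ∀ i → toℚ (lookup (x ⊕ y) i) ≡ 1ℚ * toℚ (lookup x i) + 1ℚ * toℚ (lookup y i)
    coords i = begin
      toℚ (lookup (x ⊕ y) i)                         ≡⟨ cong toℚ (lookup-⊕ x y i) ⟩
      toℚ (lookup x i ℤ.+ lookup y i)                ≡⟨ toℚ-homo-+ (lookup x i) (lookup y i) ⟩
      toℚ (lookup x i) + toℚ (lookup y i)            ≡⟨ cong₂ _+_ (ℚP.*-identityˡ (toℚ (lookup x i))) (ℚP.*-identityˡ (toℚ (lookup y i))) ⟨
      1ℚ * toℚ (lookup x i) + 1ℚ * toℚ (lookup y i)  ∎

  ⟪⟫-distribˡ-⊖ : ∀ x y z → ⟪ x ⊖ y , z ⟫ ≡ ⟪ x , z ⟫ - ⟪ y , z ⟫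
  ⟪⟫-distribˡ-⊖ x y z = begin
    ⟪ x ⊖ y , z ⟫                        ≡⟨ ⟪⟫-linearˡ 1ℚ (- 1ℚ) x y (x ⊖ y) z coords ⟩
    1ℚ * ⟪ x , z ⟫ + (- 1ℚ) * ⟪ y , z ⟫  ≡⟨ combination ⟪ x , z ⟫ ⟪ y , z ⟫ ⟨
    ⟪ x , z ⟫ - ⟪ y , z ⟫                ∎
    where
    open ≡-Reasoning
    open ℚ-Solver
    combination : ∀ a b → a - b ≡ 1ℚ * a + (- 1ℚ) * b
    combination = solve 2 (λ a b → a :- b := con 1ℚ :* a :+ (:- con 1ℚ) :* b) refl
    coords : ∀ i → toℚ (lookup (x ⊖ y) i) ≡ 1ℚ * toℚ (lookup x i) + (- 1ℚ) * toℚ (lookup y i)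
    coords i = begin
      toℚ (lookup (x ⊖ y) i)                              ≡⟨ cong toℚ (lookup-⊖ x y i) ⟩
      toℚ (lookup x i ℤ.- lookup y i)                     ≡⟨ toℚ-homo-minus (lookup x i) (lookup y i) ⟩
      toℚ (lookup x i) - toℚ (lookup y i)                 ≡⟨ combination (toℚ (lookup x i)) (toℚ (lookup y i)) ⟩
      1ℚ * toℚ (lookup x i) + (- 1ℚ) * toℚ (lookup y i)   ∎

  ⟪⟫-negʳ : ∀ x z → ⟪ z , neg x ⟫ ≡ - ⟪ z , x ⟫
  ⟪⟫-negʳ x z = begin
    ⟪ z , neg x ⟫                        ≡⟨ ⟪⟫-sym z (neg x) ⟩
    ⟪ neg x , z ⟫                        ≡⟨ ⟪⟫-linearˡ (- 1ℚ) 0ℚ x x (neg x) z coords ⟩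
    (- 1ℚ) * ⟪ x , z ⟫ + 0ℚ * ⟪ x , z ⟫  ≡⟨ combination ⟪ x , z ⟫ ⟨
    - ⟪ x , z ⟫                          ≡⟨ cong -_ (⟪⟫-sym x z) ⟩
    - ⟪ z , x ⟫                          ∎
    where
    open ≡-Reasoning
    open ℚ-Solver
    combination : ∀ a → - a ≡ (- 1ℚ) * a + 0ℚ * a
    combination = solve 1 (λ a → :- a := (:- con 1ℚ) :* a :+ con 0ℚ :* a) refl
    coords : ∀ i → toℚ (lookup (neg x) i) ≡ (- 1ℚ) * toℚ (lookup x i) + 0ℚ * toℚ (lookup x i)
    coords i = begin
      toℚ (lookup (neg x) i)                              ≡⟨ cong toℚ (lookup-neg x i) ⟩
      toℚ (ℤ.- lookup x i)                                ≡⟨ toℚ-homo‿- (lookup x i) ⟩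
      - toℚ (lookup x i)                                  ≡⟨ combination (toℚ (lookup x i)) ⟩
      (- 1ℚ) * toℚ (lookup x i) + 0ℚ * toℚ (lookup x i)   ∎

  norm²-pos : ∀ {α} → α ∈ roots → 0ℚ < ⟪ α , α ⟫
  norm²-pos {α} α∈Φ = B-posdef (toℚVec α) λ α≡0 → zero∉ (subst (_∈ roots) (toℚVec-injective-0 α α≡0) α∈Φ)

  reflection∈roots : ∀ {α δ} k → α ∈ roots → δ ∈ roots →
                     two * ⟪ δ , α ⟫ ≡ toℚ k * ⟪ α , α ⟫ → (δ ⊖ (k · α)) ∈ roots
  reflection∈roots {α} {δ} k α∈Φ δ∈Φ 2⟪δ,α⟫≡k|α|²
    with k′ , 2⟪δ,α⟫≡k′|α|² , sδ∈Φ ← reflect α∈Φ δ∈Φ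
    with refl ← toℚ-injective {k′} {k} (*-cancelʳ-≡-pos (norm²-pos α∈Φ) (trans (sym 2⟪δ,α⟫≡k′|α|²) 2⟪δ,α⟫≡k|α|²))
    = sδ∈Φ

  neg∈roots : ∀ {α} → α ∈ roots → neg α ∈ roots
  neg∈roots {α} α∈Φ = subst (_∈ roots) (⊖-2·-self α) (reflection∈roots (+ 2) α∈Φ α∈Φ refl)

  -- w = |u|² v − (u,v) u is nonzero because Φ is reduced, and (w,w) = |u|² (|u|²|v|² − (u,v)²).
  cauchy-schwarz-< : ∀ {u v} → u ∈ roots → v ∈ roots → v ≢ u → v ≢ neg u →
                     ⟪ u , v ⟫ * ⟪ u , v ⟫ < ⟪ u , u ⟫ * ⟪ v , v ⟫
  cauchy-schwarz-< {u} {v} u∈Φ v∈Φ v≢u v≢-u =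
    0<q-p⇒p<q (ℚP.*-cancelˡ-<-nonNeg a {{ℚ.nonNegative (ℚP.<⇒≤ 0<a)}}
      (subst₂ _<_ (sym (ℚP.*-zeroʳ a)) ⟪w,w⟫ (B-posdef w w≢0)))
    where
    a = ⟪ u , u ⟫
    b = ⟪ v , v ⟫
    c = ⟪ u , v ⟫
    0<a = norm²-pos u∈Φ
    instance
      a≢0 : ℚ.NonZero a
      a≢0 = ℚP.pos⇒nonZero a {{ℚ.positive 0<a}}
    u′ = toℚVec u
    v′ = toℚVec v
    w : Vec ℚ n
    w = tabulate (λ i → a * lookup v′ i + (- c) * lookup u′ i)
    lookup-w : ∀ i → lookup w i ≡ a * lookup v′ i + (- c) * lookup u′ i
    lookup-w = VecP.lookup∘tabulate _
    ⟪w,−⟫ : ∀ x → form B x w ≡ a * form B v′ x + (- c) * form B u′ x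
    ⟪w,−⟫ x = trans (form-sym B B-sym x w) (form-linearˡ B a (- c) v′ u′ w x lookup-w)
    ⟪w,w⟫ : form B w w ≡ a * (a * b - c * c)
    ⟪w,w⟫ = begin
      form B w w                                             ≡⟨ form-linearˡ B a (- c) v′ u′ w w lookup-w ⟩
      a * form B v′ w + (- c) * form B u′ w                  ≡⟨ cong₂ (λ p q → a * p + (- c) * q) (⟪w,−⟫ v′) (⟪w,−⟫ u′) ⟩
      a * (a * b + (- c) * c) + (- c) * (a * ⟪ v , u ⟫ + (- c) * a)
        ≡⟨ cong (λ p → a * (a * b + (- c) * c) + (- c) * (a * p + (- c) * a)) (⟪⟫-sym v u) ⟩
      a * (a * b + (- c) * c) + (- c) * (a * c + (- c) * a)  ≡⟨ expand a b c ⟩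
      a * (a * b - c * c)                                    ∎
      where
      open ≡-Reasoning
      open ℚ-Solver
      expand : ∀ a b c → a * (a * b + (- c) * c) + (- c) * (a * c + (- c) * a) ≡ a * (a * b - c * c)
      expand = solve 3 (λ a b c → a :* (a :* b :+ (:- c) :* c) :+ (:- c) :* (a :* c :+ (:- c) :* a)
                                  := a :* (a :* b :- c :* c)) refl
    w≢0 : w ≢ replicate n 0ℚ
    w≢0 w≡0 = [ v≢u , v≢-u ]′ (reduced u∈Φ v∈Φ (c * ℚ.1/ a , lookup-extensional λ i →
      trans (ax-cy≡0⇒x≡c/a*y a c (lookup v′ i) (lookup u′ i)
               (trans (sym (lookup-w i)) (trans (cong (λ x → lookup x i) w≡0) (VecP.lookup-replicate i 0ℚ))))
            (sym (VecP.lookup-map i (c * ℚ.1/ a *_) u′))))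

  CartanOne : ZVec n → ZVec n → Set
  CartanOne u v = two * ⟪ u , v ⟫ ≡ ⟪ v , v ⟫ × ⟪ u , u ⟫ ≤ ⟪ v , v ⟫

  CartanOne⇒⊖∈roots : ∀ {u v} → u ∈ roots → v ∈ roots → CartanOne u v → (u ⊖ v) ∈ roots
  CartanOne⇒⊖∈roots {u} {v} u∈Φ v∈Φ (2⟪u,v⟫≡|v|² , _) =
    subst (_∈ roots) (⊖-1· u v) (reflection∈roots (+ 1) v∈Φ u∈Φ (trans 2⟪u,v⟫≡|v|² (sym (ℚP.*-identityˡ _))))

  CartanOne⇒2⟪⟫≡⊔ : ∀ {u v} → CartanOne u v → two * ⟪ u , v ⟫ ≡ ⟪ u , u ⟫ ⊔ ⟪ v , v ⟫
  CartanOne⇒2⟪⟫≡⊔ (2⟪u,v⟫≡|v|² , |u|≤|v|) = trans 2⟪u,v⟫≡|v|² (sym (ℚP.p≤q⇒p⊔q≡q |u|≤|v|))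

  cartan-integer-pos : ∀ {u v} k → v ∈ roots → 0ℚ < ⟪ u , v ⟫ → two * ⟪ u , v ⟫ ≡ toℚ k * ⟪ v , v ⟫ → + 0 ℤ.< k
  cartan-integer-pos {u} {v} k v∈Φ 0<⟪u,v⟫ 2⟪u,v⟫≡k|v|² =
    toℚ-cancel-< (0<p*r⇒0<p (norm²-pos v∈Φ) (subst (0ℚ <_) 2⟪u,v⟫≡k|v|² (0<p⇒0<two*p 0<⟪u,v⟫)))

  cartan-integers-product<4 : ∀ {u v} k l → u ∈ roots → v ∈ roots → v ≢ u → v ≢ neg u →
                              two * ⟪ u , v ⟫ ≡ toℚ k * ⟪ v , v ⟫ → two * ⟪ v , u ⟫ ≡ toℚ l * ⟪ u , u ⟫ →
                              k ℤ.* l ℤ.< + 4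
  cartan-integers-product<4 {u} {v} k l u∈Φ v∈Φ v≢u v≢-u 2c≡k|v|² 2c′≡l|u|² =
    toℚ-cancel-< (subst (_< toℚ (+ 4)) (sym (toℚ-homo-* k l))
      (ℚP.*-cancelʳ-<-nonNeg (a * b) {{ℚ.nonNegative (ℚP.<⇒≤ 0<ab)}}
        (subst (_< toℚ (+ 4) * (a * b)) (sym kl*ab≡4c²)
          (ℚP.*-monoʳ-<-pos (toℚ (+ 4)) (cauchy-schwarz-< u∈Φ v∈Φ v≢u v≢-u)))))
    where
    a = ⟪ u , u ⟫
    b = ⟪ v , v ⟫
    c = ⟪ u , v ⟫
    0<ab : 0ℚ < a * b
    0<ab = ℚP.positive⁻¹ (a * b) {{ℚP.pos*pos⇒pos a {{ℚ.positive (norm²-pos u∈Φ)}} b {{ℚ.positive (norm²-pos v∈Φ)}}}}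
    kl*ab≡4c² : (toℚ k * toℚ l) * (a * b) ≡ toℚ (+ 4) * (c * c)
    kl*ab≡4c² = begin
      (toℚ k * toℚ l) * (a * b)    ≡⟨ solve 4 (λ k l a b → (k :* l) :* (a :* b) := (k :* b) :* (l :* a)) refl (toℚ k) (toℚ l) a b ⟩
      (toℚ k * b) * (toℚ l * a)    ≡⟨ cong₂ _*_ (sym 2c≡k|v|²) (trans (sym 2c′≡l|u|²) (cong (two *_) (⟪⟫-sym v u))) ⟩
      (two * c) * (two * c)        ≡⟨ solve 1 (λ c → (con two :* c) :* (con two :* c) := con (toℚ (+ 4)) :* (c :* c)) refl c ⟩
      toℚ (+ 4) * (c * c)          ∎
      where
      open ≡-Reasoning
      open ℚ-Solver

  cartan-integer-1⇒CartanOne : ∀ {u v} m → u ∈ roots → + 0 ℤ.< m →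
                               two * ⟪ u , v ⟫ ≡ toℚ (+ 1) * ⟪ v , v ⟫ → two * ⟪ v , u ⟫ ≡ toℚ m * ⟪ u , u ⟫ →
                               CartanOne u v
  cartan-integer-1⇒CartanOne {u} {v} m u∈Φ 0<m 2⟪u,v⟫≡1|v|² 2⟪v,u⟫≡m|u|² = 2⟪u,v⟫≡|v|² ,
    subst (⟪ u , u ⟫ ≤_) (trans (sym 2⟪v,u⟫≡m|u|²) (trans (cong (two *_) (⟪⟫-sym v u)) 2⟪u,v⟫≡|v|²))
      (0<k⇒p≤k*p 0<m (ℚP.<⇒≤ (norm²-pos u∈Φ)))
    where
    2⟪u,v⟫≡|v|² = trans 2⟪u,v⟫≡1|v|² (ℚP.*-identityˡ ⟪ v , v ⟫)

  acute⇒CartanOne : ∀ {u v} → u ∈ roots → v ∈ roots → v ≢ u → v ≢ neg u → 0ℚ < ⟪ u , v ⟫ →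
                    CartanOne u v ⊎ CartanOne v u
  acute⇒CartanOne {u} {v} u∈Φ v∈Φ v≢u v≢-u 0<⟪u,v⟫ =
    let k , 2⟪u,v⟫≡k|v|² , _ = reflect v∈Φ u∈Φ
        l , 2⟪v,u⟫≡l|u|² , _ = reflect u∈Φ v∈Φ
        0<k = cartan-integer-pos {u} {v} k v∈Φ 0<⟪u,v⟫ 2⟪u,v⟫≡k|v|²
        0<l = cartan-integer-pos {v} {u} l u∈Φ (subst (0ℚ <_) (⟪⟫-sym u v) 0<⟪u,v⟫) 2⟪v,u⟫≡l|u|²
    in [ (λ k≡1 → inj₁ (cartan-integer-1⇒CartanOne {u} {v} l u∈Φ 0<l
                          (subst (λ k → two * ⟪ u , v ⟫ ≡ toℚ k * ⟪ v , v ⟫) k≡1 2⟪u,v⟫≡k|v|²) 2⟪v,u⟫≡l|u|²))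
       , (λ l≡1 → inj₂ (cartan-integer-1⇒CartanOne {v} {u} k v∈Φ 0<k
                          (subst (λ l → two * ⟪ v , u ⟫ ≡ toℚ l * ⟪ u , u ⟫) l≡1 2⟪v,u⟫≡l|u|²) 2⟪u,v⟫≡k|v|²))
       ]′ (positive-factors-of-<4 k l 0<k 0<l
            (cartan-integers-product<4 {u} {v} k l u∈Φ v∈Φ v≢u v≢-u 2⟪u,v⟫≡k|v|² 2⟪v,u⟫≡l|u|²))

  acute⇒⊖∈roots : ∀ {u v} → u ∈ roots → v ∈ roots → v ≢ u → v ≢ neg u → 0ℚ < ⟪ u , v ⟫ → (u ⊖ v) ∈ roots
  acute⇒⊖∈roots {u} {v} u∈Φ v∈Φ v≢u v≢-u 0<⟪u,v⟫ =
    [ CartanOne⇒⊖∈roots u∈Φ v∈Φ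
    , (λ c → subst (_∈ roots) (neg-⊖ v u) (neg∈roots (CartanOne⇒⊖∈roots v∈Φ u∈Φ c)))
    ]′ (acute⇒CartanOne u∈Φ v∈Φ v≢u v≢-u 0<⟪u,v⟫)

  acute⇒2⟪⟫≡⊔ : ∀ {u v} → u ∈ roots → v ∈ roots → v ≢ u → v ≢ neg u → 0ℚ < ⟪ u , v ⟫ →
                two * ⟪ u , v ⟫ ≡ ⟪ u , u ⟫ ⊔ ⟪ v , v ⟫
  acute⇒2⟪⟫≡⊔ {u} {v} u∈Φ v∈Φ v≢u v≢-u 0<⟪u,v⟫ =
    [ CartanOne⇒2⟪⟫≡⊔ {u} {v}
    , (λ c → trans (cong (two *_) (⟪⟫-sym u v)) (trans (CartanOne⇒2⟪⟫≡⊔ {v} {u} c) (ℚP.⊔-comm ⟪ v , v ⟫ ⟪ u , u ⟫)))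
    ]′ (acute⇒CartanOne u∈Φ v∈Φ v≢u v≢-u 0<⟪u,v⟫)

  ⊖∈roots⇒comparable : ∀ {x y} → (x ⊖ y) ∈ roots → y ≼ x ⊎ x ≼ y
  ⊖∈roots⇒comparable {x} {y} x-y∈Φ = Data.Sum.map (⊖-nonNeg⇒≼ {x = x} {y}) (⊖-nonPos⇒≼ {x = x} {y}) (simple x-y∈Φ)

  ⟪⟫-cong-⊕ : ∀ {a b c d} x → a ⊕ b ≡ c ⊕ d → ⟪ x , a ⟫ + ⟪ x , b ⟫ ≡ ⟪ x , c ⟫ + ⟪ x , d ⟫
  ⟪⟫-cong-⊕ {a} {b} {c} {d} x a+b≡c+d =
    trans (sym (⟪⟫-distribʳ-⊕ a b x)) (trans (cong ⟪ x ,_⟫ a+b≡c+d) (⟪⟫-distribʳ-⊕ c d x))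

  -- If neither z nor w were longer than x, both would pair with x to |x|²/2, forcing (x, y) = 0.
  acute-sum⇒longer : ∀ {x y z w} → ⟪ x , x ⟫ + ⟪ x , y ⟫ ≡ ⟪ x , z ⟫ + ⟪ x , w ⟫ → 0ℚ < ⟪ x , y ⟫ →
                     two * ⟪ x , z ⟫ ≡ ⟪ x , x ⟫ ⊔ ⟪ z , z ⟫ → two * ⟪ x , w ⟫ ≡ ⟪ x , x ⟫ ⊔ ⟪ w , w ⟫ →
                     ⟪ x , x ⟫ < ⟪ z , z ⟫ ⊎ ⟪ x , x ⟫ < ⟪ w , w ⟫
  acute-sum⇒longer {x} {y} {z} {w} eq 0<⟪x,y⟫ 2⟪x,z⟫≡⊔ 2⟪x,w⟫≡⊔
    with ⟪ x , x ⟫ ℚP.<? ⟪ z , z ⟫ | ⟪ x , x ⟫ ℚP.<? ⟪ w , w ⟫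
  ... | yes x<z | _       = inj₁ x<z
  ... | no _    | yes x<w = inj₂ x<w
  ... | no x≮z  | no x≮w  = ⊥-elim (ℚP.<-irrefl (sym ⟪x,y⟫≡0) 0<⟪x,y⟫)
    where
    half : ∀ v → ¬ (⟪ x , x ⟫ < ⟪ v , v ⟫) → two * ⟪ x , v ⟫ ≡ ⟪ x , x ⟫ ⊔ ⟪ v , v ⟫ → two * ⟪ x , v ⟫ ≡ ⟪ x , x ⟫
    half v x≮v 2⟪x,v⟫≡⊔ = trans 2⟪x,v⟫≡⊔ (ℚP.p≥q⇒p⊔q≡p (ℚP.≮⇒≥ x≮v))
    ⟪x,y⟫≡0 : ⟪ x , y ⟫ ≡ 0ℚ
    ⟪x,y⟫≡0 = +-cancelˡ ⟪ x , x ⟫ ⟪ x , y ⟫ 0ℚ (begin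
      ⟪ x , x ⟫ + ⟪ x , y ⟫  ≡⟨ eq ⟩
      ⟪ x , z ⟫ + ⟪ x , w ⟫  ≡⟨ halves-sum {⟪ x , z ⟫} {⟪ x , w ⟫} (half z x≮z 2⟪x,z⟫≡⊔) (half w x≮w 2⟪x,w⟫≡⊔) ⟩
      ⟪ x , x ⟫              ≡⟨ ℚP.+-identityʳ ⟪ x , x ⟫ ⟨
      ⟪ x , x ⟫ + 0ℚ         ∎)
      where
      open ≡-Reasoning

module AbelianIdealProperties {n : ℕ} (R : RootSystem n) {I : ZVec n → Set} (AI : AbelianIdeal R I) where
  open RootSystem R
  open RootSystemProperties R
  open AbelianIdeal AI

  ∈I⇒∈Φ : ∀ {u} → I u → u ∈ roots
  ∈I⇒∈Φ u∈I = proj₁ (⊆pos u∈I)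

  ∈I-not-opposite : ∀ {u v} → I u → I v → v ≢ neg u
  ∈I-not-opposite {u} {v} u∈I v∈I v≡-u = zero∉ (subst (_∈ roots) v≡0 (∈I⇒∈Φ v∈I))
    where
    v≡0 = nonNeg∧nonPos⇒0 (proj₂ (⊆pos v∈I)) (subst isNonPos (sym v≡-u) (neg-nonNeg {x = u} (proj₂ (⊆pos u∈I))))

  ∈I-acute⇒⊖∈roots : ∀ {u v} → I u → I v → v ≢ u → 0ℚ < ⟪ u , v ⟫ → (u ⊖ v) ∈ roots
  ∈I-acute⇒⊖∈roots u∈I v∈I v≢u = acute⇒⊖∈roots (∈I⇒∈Φ u∈I) (∈I⇒∈Φ v∈I) v≢u (∈I-not-opposite u∈I v∈I)

  ∈I-acute⇒2⟪⟫≡⊔ : ∀ {u v} → I u → I v → v ≢ u → 0ℚ < ⟪ u , v ⟫ → two * ⟪ u , v ⟫ ≡ ⟪ u , u ⟫ ⊔ ⟪ v , v ⟫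
  ∈I-acute⇒2⟪⟫≡⊔ u∈I v∈I v≢u = acute⇒2⟪⟫≡⊔ (∈I⇒∈Φ u∈I) (∈I⇒∈Φ v∈I) v≢u (∈I-not-opposite u∈I v∈I)

  ∈I-pairing-nonNeg : ∀ {u v} → I u → I v → 0ℚ ≤ ⟪ u , v ⟫
  ∈I-pairing-nonNeg {u} {v} u∈I v∈I = ℚP.≮⇒≥ λ ⟪u,v⟫<0 →
    abelian u∈I v∈I (subst (_∈ roots) (⊖-neg u v)
      (acute⇒⊖∈roots (∈I⇒∈Φ u∈I) (neg∈roots (∈I⇒∈Φ v∈I)) (≢-sym (∈I-not-opposite v∈I u∈I))
        (λ -v≡-u → ℚP.<-asym ⟪u,v⟫<0 (subst (λ w → 0ℚ < ⟪ u , w ⟫) (sym (neg-injective -v≡-u)) (norm²-pos (∈I⇒∈Φ u∈I))))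
        (subst (0ℚ <_) (sym (⟪⟫-negʳ v u)) (ℚP.neg-antimono-< ⟪u,v⟫<0))))

  ∈I-sum-¬orthogonal : ∀ {β₁ β₂ γ₁ γ₂} → I β₁ → I β₂ → I γ₁ → I γ₂ → β₁ ⊕ β₂ ≡ γ₁ ⊕ γ₂ →
                       β₁ ≢ γ₂ → β₂ ≢ γ₂ → ⟪ β₁ , γ₁ ⟫ ≢ 0ℚ
  ∈I-sum-¬orthogonal {β₁} {β₂} {γ₁} {γ₂} β₁∈I β₂∈I γ₁∈I γ₂∈I sums β₁≢γ₂ β₂≢γ₂ ⟪β₁,γ₁⟫≡0 =
    abelian β₁∈I γ₁∈I (subst (_∈ roots) (neg-[⊖-2·] β₁ γ₁)
      (neg∈roots (reflection∈roots (+ 2) (∈I⇒∈Φ γ₁∈I) δ∈Φ (cong (two *_) ⟪δ,γ₁⟫≡|γ₁|²))))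
    where
    b = ⟪ β₁ , β₁ ⟫
    q = ⟪ β₁ , β₂ ⟫
    p = ⟪ β₁ , γ₂ ⟫
    r = ⟪ γ₂ , γ₁ ⟫
    g = ⟪ γ₂ , γ₂ ⟫
    X = ⟪ γ₂ , β₂ ⟫
    0<b = norm²-pos (∈I⇒∈Φ β₁∈I)
    0≤q = ∈I-pairing-nonNeg β₁∈I β₂∈I
    p≡b+q : p ≡ b + q
    p≡b+q = trans (sym (ℚP.+-identityˡ p)) (trans (cong (_+ p) (sym ⟪β₁,γ₁⟫≡0)) (sym (⟪⟫-cong-⊕ β₁ sums)))
    b<2p : b < two * p
    b<2p = begin-strict
      b                  ≡⟨ ℚP.+-identityʳ b ⟨
      b + 0ℚ             <⟨ ℚP.+-monoʳ-< b (ℚP.+-mono-<-≤ 0<b (ℚP.+-mono-≤ 0≤q 0≤q)) ⟩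
      b + (b + (q + q))  ≡⟨ solve 2 (λ b q → b :+ (b :+ (q :+ q)) := con two :* (b :+ q)) refl b q ⟩
      two * (b + q)      ≡⟨ cong (two *_) p≡b+q ⟨
      two * p            ∎
      where
      open ℚP.≤-Reasoning
      open ℚ-Solver
    0<p : 0ℚ < p
    0<p = subst (0ℚ <_) (sym p≡b+q) (ℚP.+-mono-<-≤ 0<b 0≤q)
    2p≡g : two * p ≡ g
    2p≡g = trans 2p≡b⊔g (p<p⊔q⇒p⊔q≡q (subst (b <_) 2p≡b⊔g b<2p))
      where
      2p≡b⊔g = ∈I-acute⇒2⟪⟫≡⊔ β₁∈I γ₂∈I (≢-sym β₁≢γ₂) 0<p
    X≡r+p : X ≡ r + p
    X≡r+p = begin
      X                      ≡⟨ solve 2 (λ p X → X := (p :+ X) :- p) refl p X ⟩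
      (p + X) - p            ≡⟨ cong (_- p) (trans (cong (_+ X) (⟪⟫-sym β₁ γ₂)) (⟪⟫-cong-⊕ γ₂ sums)) ⟩
      (r + g) - p            ≡⟨ cong (λ t → (r + t) - p) 2p≡g ⟨
      (r + two * p) - p      ≡⟨ solve 2 (λ r p → (r :+ con two :* p) :- p := r :+ p) refl r p ⟩
      r + p                  ∎
      where
      open ≡-Reasoning
      open ℚ-Solver
    0<⟪β₂,γ₂⟫ : 0ℚ < ⟪ β₂ , γ₂ ⟫
    0<⟪β₂,γ₂⟫ = subst (0ℚ <_) (trans (sym X≡r+p) (⟪⟫-sym γ₂ β₂)) (ℚP.+-mono-≤-< (∈I-pairing-nonNeg γ₂∈I γ₁∈I) 0<p)
    δ∈Φ : (γ₁ ⊖ β₁) ∈ roots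
    δ∈Φ = subst (_∈ roots) (⊕-≡⇒⊖-≡ sums) (∈I-acute⇒⊖∈roots β₂∈I γ₂∈I (≢-sym β₂≢γ₂) 0<⟪β₂,γ₂⟫)
    ⟪δ,γ₁⟫≡|γ₁|² : ⟪ γ₁ ⊖ β₁ , γ₁ ⟫ ≡ ⟪ γ₁ , γ₁ ⟫
    ⟪δ,γ₁⟫≡|γ₁|² = trans (⟪⟫-distribˡ-⊖ γ₁ β₁ γ₁)
      (trans (cong (_-_ ⟪ γ₁ , γ₁ ⟫) ⟪β₁,γ₁⟫≡0) (solve 1 (λ x → x :- con 0ℚ := x) refl ⟪ γ₁ , γ₁ ⟫))
      where
      open ℚ-Solver

  ∈I-sum-pairing-pos : ∀ {β₁ β₂ γ₁ γ₂} → I β₁ → I β₂ → I γ₁ → I γ₂ → β₁ ⊕ β₂ ≡ γ₁ ⊕ γ₂ →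
                       β₁ ≢ γ₂ → β₂ ≢ γ₂ → 0ℚ < ⟪ β₁ , γ₁ ⟫
  ∈I-sum-pairing-pos β₁∈I β₂∈I γ₁∈I γ₂∈I sums β₁≢γ₂ β₂≢γ₂ = ≤∧≢⇒< (∈I-pairing-nonNeg β₁∈I γ₁∈I)
    (≢-sym (∈I-sum-¬orthogonal β₁∈I β₂∈I γ₁∈I γ₂∈I sums β₁≢γ₂ β₂≢γ₂))

module Configuration {n : ℕ} (R : RootSystem n) {I : ZVec n → Set} (AI : AbelianIdeal R I)
  {β₁ β₂ γ₁ γ₂ : ZVec n} (β₁∈I : I β₁) (β₂∈I : I β₂) (γ₁∈I : I γ₁) (γ₂∈I : I γ₂)
  (sums : β₁ ⊕ β₂ ≡ γ₁ ⊕ γ₂)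
  (β₁≢γ₁ : β₁ ≢ γ₁) (β₁≢γ₂ : β₁ ≢ γ₂) (β₂≢γ₁ : β₂ ≢ γ₁) (β₂≢γ₂ : β₂ ≢ γ₂) (β₁≢β₂ : β₁ ≢ β₂) where
  open RootSystem R
  open RootSystemProperties R
  open AbelianIdealProperties R AI

  IsBeta IsGamma : ZVec n → Set
  IsBeta β = β ≡ β₁ ⊎ β ≡ β₂
  IsGamma γ = γ ≡ γ₁ ⊎ γ ≡ γ₂

  sums-swap₁₂ : β₂ ⊕ β₁ ≡ γ₁ ⊕ γ₂
  sums-swap₁₂ = trans (⊕-comm β₂ β₁) sums

  acute : ∀ β → IsBeta β → ∀ γ → IsGamma γ → 0ℚ < ⟪ β , γ ⟫
  acute _ (inj₁ refl) _ (inj₁ refl) = ∈I-sum-pairing-pos β₁∈I β₂∈I γ₁∈I γ₂∈I sums β₁≢γ₂ β₂≢γ₂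
  acute _ (inj₁ refl) _ (inj₂ refl) = ∈I-sum-pairing-pos β₁∈I β₂∈I γ₂∈I γ₁∈I (trans sums (⊕-comm γ₁ γ₂)) β₁≢γ₁ β₂≢γ₁
  acute _ (inj₂ refl) _ (inj₁ refl) = ∈I-sum-pairing-pos β₂∈I β₁∈I γ₁∈I γ₂∈I sums-swap₁₂ β₂≢γ₂ β₁≢γ₂
  acute _ (inj₂ refl) _ (inj₂ refl) = ∈I-sum-pairing-pos β₂∈I β₁∈I γ₂∈I γ₁∈I (trans sums-swap₁₂ (⊕-comm γ₁ γ₂)) β₂≢γ₁ β₁≢γ₁

  β∈I : ∀ {β} → IsBeta β → I β
  β∈I (inj₁ refl) = β₁∈I
  β∈I (inj₂ refl) = β₂∈I

  γ∈I : ∀ {γ} → IsGamma γ → I γ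
  γ∈I (inj₁ refl) = γ₁∈I
  γ∈I (inj₂ refl) = γ₂∈I

  γ≢β : ∀ {β γ} → IsBeta β → IsGamma γ → γ ≢ β
  γ≢β (inj₁ refl) (inj₁ refl) = ≢-sym β₁≢γ₁
  γ≢β (inj₁ refl) (inj₂ refl) = ≢-sym β₁≢γ₂
  γ≢β (inj₂ refl) (inj₁ refl) = ≢-sym β₂≢γ₁
  γ≢β (inj₂ refl) (inj₂ refl) = ≢-sym β₂≢γ₂

  β⊖γ∈Φ : ∀ β → IsBeta β → ∀ γ → IsGamma γ → (β ⊖ γ) ∈ roots
  β⊖γ∈Φ β isβ γ isγ = ∈I-acute⇒⊖∈roots (β∈I isβ) (γ∈I isγ) (γ≢β isβ isγ) (acute β isβ γ isγ)

  2⟪β,γ⟫≡⊔ : ∀ β → IsBeta β → ∀ γ → IsGamma γ → two * ⟪ β , γ ⟫ ≡ ⟪ β , β ⟫ ⊔ ⟪ γ , γ ⟫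
  2⟪β,γ⟫≡⊔ β isβ γ isγ = ∈I-acute⇒2⟪⟫≡⊔ (β∈I isβ) (γ∈I isγ) (γ≢β isβ isγ) (acute β isβ γ isγ)

  extremal-pair : ExtremalPair β₁ β₂ γ₁ γ₂
  extremal-pair = comparable⇒ExtremalPair sums (⊖∈roots⇒comparable (β⊖γ∈Φ β₁ (inj₁ refl) γ₁ (inj₁ refl)))
                                               (⊖∈roots⇒comparable (β⊖γ∈Φ β₁ (inj₁ refl) γ₂ (inj₂ refl)))

  ShorterThanAγ : ZVec n → Set
  ShorterThanAγ β = ⟪ β , β ⟫ < ⟪ γ₁ , γ₁ ⟫ ⊎ ⟪ β , β ⟫ < ⟪ γ₂ , γ₂ ⟫

  shorter⇒short : ∀ {β} → ShorterThanAγ β → IsShort R β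
  shorter⇒short = [ (λ lt → γ₁ , ∈I⇒∈Φ γ₁∈I , lt) , (λ lt → γ₂ , ∈I⇒∈Φ γ₂∈I , lt) ]′

  module _ (0<q : 0ℚ < ⟪ β₁ , β₂ ⟫) where

    β₁-shorter : ShorterThanAγ β₁
    β₁-shorter = acute-sum⇒longer {β₁} {β₂} {γ₁} {γ₂} (⟪⟫-cong-⊕ β₁ sums) 0<q
                   (2⟪β,γ⟫≡⊔ β₁ (inj₁ refl) γ₁ (inj₁ refl)) (2⟪β,γ⟫≡⊔ β₁ (inj₁ refl) γ₂ (inj₂ refl))

    β₂-shorter : ShorterThanAγ β₂
    β₂-shorter = acute-sum⇒longer {β₂} {β₁} {γ₁} {γ₂} (⟪⟫-cong-⊕ β₂ sums-swap₁₂) (subst (0ℚ <_) (⟪⟫-sym β₁ β₂) 0<q)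
                   (2⟪β,γ⟫≡⊔ β₂ (inj₂ refl) γ₁ (inj₁ refl)) (2⟪β,γ⟫≡⊔ β₂ (inj₂ refl) γ₂ (inj₂ refl))

    module EqualLengths (g₁≡g₂ : ⟪ γ₁ , γ₁ ⟫ ≡ ⟪ γ₂ , γ₂ ⟫) where

      g = ⟪ γ₁ , γ₁ ⟫
      q = ⟪ β₁ , β₂ ⟫
      b₁ = ⟪ β₁ , β₁ ⟫

      γ-norm : ∀ {γ} → IsGamma γ → ⟪ γ , γ ⟫ ≡ g
      γ-norm (inj₁ refl) = refl
      γ-norm (inj₂ refl) = sym g₁≡g₂

      2⟪β,γ⟫≡g : ∀ β → IsBeta β → ShorterThanAγ β → ∀ γ → IsGamma γ → two * ⟪ β , γ ⟫ ≡ g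
      2⟪β,γ⟫≡g β isβ β-shorter γ isγ = begin
        two * ⟪ β , γ ⟫        ≡⟨ 2⟪β,γ⟫≡⊔ β isβ γ isγ ⟩
        ⟪ β , β ⟫ ⊔ ⟪ γ , γ ⟫  ≡⟨ ℚP.p≤q⇒p⊔q≡q (ℚP.<⇒≤ (subst (⟪ β , β ⟫ <_) (sym (γ-norm isγ)) β<g)) ⟩
        ⟪ γ , γ ⟫              ≡⟨ γ-norm isγ ⟩
        g                      ∎
        where
        open ≡-Reasoning
        β<g = [ (λ lt → lt) , subst (⟪ β , β ⟫ <_) (sym g₁≡g₂) ]′ β-shorter

      pairings-sum≡g : ∀ β → IsBeta β → ShorterThanAγ β → ⟪ β , γ₁ ⟫ + ⟪ β , γ₂ ⟫ ≡ g
      pairings-sum≡g β isβ β-shorter = halves-sum {⟪ β , γ₁ ⟫} {⟪ β , γ₂ ⟫}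
        (2⟪β,γ⟫≡g β isβ β-shorter γ₁ (inj₁ refl)) (2⟪β,γ⟫≡g β isβ β-shorter γ₂ (inj₂ refl))

      b₁+q≡g : b₁ + q ≡ g
      b₁+q≡g = trans (⟪⟫-cong-⊕ β₁ sums) (pairings-sum≡g β₁ (inj₁ refl) β₁-shorter)

      b₂+q≡g : ⟪ β₂ , β₂ ⟫ + q ≡ g
      b₂+q≡g = trans (cong (_+_ ⟪ β₂ , β₂ ⟫) (⟪⟫-sym β₁ β₂))
                     (trans (⟪⟫-cong-⊕ β₂ sums-swap₁₂) (pairings-sum≡g β₂ (inj₂ refl) β₂-shorter))

      2q≡b₁ : two * q ≡ b₁
      2q≡b₁ = begin
        two * q           ≡⟨ ∈I-acute⇒2⟪⟫≡⊔ β₁∈I β₂∈I (≢-sym β₁≢β₂) 0<q ⟩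
        b₁ ⊔ ⟪ β₂ , β₂ ⟫  ≡⟨ cong (b₁ ⊔_) (+-cancelʳ q b₁ ⟪ β₂ , β₂ ⟫ (trans b₁+q≡g (sym b₂+q≡g))) ⟨
        b₁ ⊔ b₁           ≡⟨ ℚP.⊔-idem b₁ ⟩
        b₁                ∎
        where
        open ≡-Reasoning

      cartan = reflect (∈I⇒∈Φ β₁∈I) (∈I⇒∈Φ γ₁∈I)
      k = proj₁ cartan

      b₁+q≡kb₁ : b₁ + q ≡ toℚ k * b₁
      b₁+q≡kb₁ = begin
        b₁ + q             ≡⟨ b₁+q≡g ⟩
        g                  ≡⟨ 2⟪β,γ⟫≡g β₁ (inj₁ refl) β₁-shorter γ₁ (inj₁ refl) ⟨
        two * ⟪ β₁ , γ₁ ⟫  ≡⟨ cong (two *_) (⟪⟫-sym β₁ γ₁) ⟩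
        two * ⟪ γ₁ , β₁ ⟫  ≡⟨ proj₁ (proj₂ cartan) ⟩
        toℚ k * b₁         ∎
        where
        open ≡-Reasoning

      absurd : ⊥
      absurd = b+b/2≢k*b k (norm²-pos (∈I⇒∈Φ β₁∈I)) 2q≡b₁ b₁+q≡kb₁

    γ-norms-differ : ⟪ γ₁ , γ₁ ⟫ ≢ ⟪ γ₂ , γ₂ ⟫
    γ-norms-differ g₁≡g₂ = EqualLengths.absurd g₁≡g₂

  orthogonal-unless-short : ¬ (IsShort R β₁ × IsShort R β₂ × (⟪ γ₁ , γ₁ ⟫ ≢ ⟪ γ₂ , γ₂ ⟫)) → ⟪ β₁ , β₂ ⟫ ≡ 0ℚ
  orthogonal-unless-short exception with ⟪ β₁ , β₂ ⟫ ℚP.≟ 0ℚ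
  ... | yes q≡0 = q≡0
  ... | no q≢0  = ⊥-elim (exception (shorter⇒short {β₁} (β₁-shorter 0<q) , shorter⇒short {β₂} (β₂-shorter 0<q) ,
                                     γ-norms-differ 0<q))
    where
    0<q = ≤∧≢⇒< (∈I-pairing-nonNeg β₁∈I β₂∈I) (≢-sym q≢0)

proposition4p3 : {n : ℕ} (R : RootSystem n) (I : ZVec n → Set) → AbelianIdeal R I →
  (β₁ β₂ γ₁ γ₂ : ZVec n) → I β₁ → I β₂ → I γ₁ → I γ₂ →
  (β₁ ⊕ β₂) ≡ (γ₁ ⊕ γ₂) →
  β₁ ≢ γ₁ → β₁ ≢ γ₂ → β₂ ≢ γ₁ → β₂ ≢ γ₂ →
  β₁ ≢ β₂ →
  let open RootSystem R in
  -- (1)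
  ((β : ZVec n) → (β ≡ β₁ ⊎ β ≡ β₂) → (γ : ZVec n) → (γ ≡ γ₁ ⊎ γ ≡ γ₂) →
    (0ℚ ℚ.< ⟪ β , γ ⟫) × ((β ⊖ γ) ∈ roots))
  -- (2)
  × (Σ (ZVec n) λ m → Σ (ZVec n) λ M →
      (m ≡ β₁ ⊎ m ≡ β₂ ⊎ m ≡ γ₁ ⊎ m ≡ γ₂)
      × (M ≡ β₁ ⊎ M ≡ β₂ ⊎ M ≡ γ₁ ⊎ M ≡ γ₂)
      × ((x : ZVec n) → (x ≡ β₁ ⊎ x ≡ β₂ ⊎ x ≡ γ₁ ⊎ x ≡ γ₂) → (m ≼ x) × (x ≼ M))
      × (((β₁ ≡ m × β₂ ≡ M) ⊎ (β₁ ≡ M × β₂ ≡ m))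
         ⊎ ((γ₁ ≡ m × γ₂ ≡ M) ⊎ (γ₁ ≡ M × γ₂ ≡ m))))
  -- (3)
  × (¬ (IsShort R β₁ × IsShort R β₂ × (⟪ γ₁ , γ₁ ⟫ ≢ ⟪ γ₂ , γ₂ ⟫)) →
      ⟪ β₁ , β₂ ⟫ ≡ 0ℚ)
proposition4p3 R I AI β₁ β₂ γ₁ γ₂ β₁∈I β₂∈I γ₁∈I γ₂∈I sums β₁≢γ₁ β₁≢γ₂ β₂≢γ₁ β₂≢γ₂ β₁≢β₂ =
  (λ β isβ γ isγ → acute β isβ γ isγ , β⊖γ∈Φ β isβ γ isγ) , extremal-pair , orthogonal-unless-short
  where
  open Configuration R AI β₁∈I β₂∈I γ₁∈I γ₂∈I sums β₁≢γ₁ β₁≢γ₂ β₂≢γ₁ β₂≢γ₂ β₁≢β₂
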